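{- If $G$ and $H$ are graphs without isolated vertices, then their Cartesian product $G\,\square\, H$ is a $(2,2)$-dominated graph.
   Context: A set $D\subseteq V(F)$ is a $2$-dominating set of a graph $F$ if every vertex of $V(F)\setminus D$ is joined by at least two edges to a vertex or vertices of $D$. A graph $F$ is $(2,2)$-dominated if there exist two proper, disjoint subsets $D_1,D_2\subseteq V(F)$ that are both $2$-dominating sets of $F$. $G\,\square\, H$ denotes the Cartesian product of $G$ and $H$. -}

module Defs where

open import Data.Nat using (ℕ; _*_; _≥_)
open import Data.Bool using (Bool; true; false; _∧_; _∨_)
open import Data.Fin using (Fin; remQuot)
open import Data.Fin.Subset using (Subset; _∈_; _∉_; _∩_; ∣_∣; Empty)
open import Data.Vec using (tabulate)
open import Data.Product using (Σ; ∃; _×_; _,_)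
open import Relation.Binary.PropositionalEquality using (_≡_)
open import Relation.Nullary.Decidable using (⌊_⌋)
open import Data.Fin.Properties using (_≟_)
open import Relation.Nullary using (yes; no)
open import Data.Empty using (⊥-elim)
open import Relation.Binary.PropositionalEquality using (refl; cong₂; sym)

record Graph : Set where
  field
    n     : ℕ
    adj   : Fin n → Fin n → Bool
    adj-sym : ∀ u v → adj u v ≡ adj v u
    irref : ∀ v → adj v v ≡ false
open Graph public

N : (G : Graph) → Fin (n G) → Subset (n G)
N G v = tabulate (adj G v)

NoIsolated : Graph → Set
NoIsolated G = ∀ v → ∃ λ u → adj G v u ≡ true

TwoDominating : (G : Graph) → Subset (n G) → Set
TwoDominating G D = ∀ v → v ∉ D → ∣ N G v ∩ D ∣ ≥ 2

Proper : (G : Graph) → Subset (n G) → Set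
Proper G D = ∃ λ v → v ∉ D

TwoTwoDominated : Graph → Set
TwoTwoDominated G =
  Σ (Subset (n G)) λ D₁ → Σ (Subset (n G)) λ D₂ →
    Proper G D₁ × Proper G D₂ × Empty (D₁ ∩ D₂) ×
    TwoDominating G D₁ × TwoDominating G D₂

_==_ : ∀ {k} → Fin k → Fin k → Bool
i == j = ⌊ i ≟ j ⌋

□adj : (G H : Graph) → (Fin (n G) × Fin (n H)) → (Fin (n G) × Fin (n H)) → Bool
□adj G H (g , h) (g′ , h′) =
  ((g == g′) ∧ adj H h h′) ∨ ((h == h′) ∧ adj G g g′)

-- Cartesian product G □ H; the vertex (g , h) is encoded as
-- combine g h : Fin (n G * n H), decoded by remQuot.
_□_ : Graph → Graph → Graph
G □ H = record
  { n     = n G * n H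
  ; adj   = λ x y → □adj G H (remQuot (n H) x) (remQuot (n H) y)
  ; adj-sym = λ x y → □sym (remQuot (n H) x) (remQuot (n H) y)
  ; irref = λ x → □irr (remQuot (n H) x)
  }
  where
  ==-sym : ∀ {k} (i j : Fin k) → (i == j) ≡ (j == i)
  ==-sym i j with i ≟ j | j ≟ i
  ... | yes _ | yes _ = refl
  ... | no _  | no _  = refl
  ... | yes p | no q  = ⊥-elim (q (sym p))
  ... | no p  | yes q = ⊥-elim (p (sym q))
  □sym : ∀ x y → □adj G H x y ≡ □adj G H y x
  □sym (g , h) (g′ , h′) =
    cong₂ _∨_ (cong₂ _∧_ (==-sym g g′) (adj-sym H h h′))
              (cong₂ _∧_ (==-sym h h′) (adj-sym G g g′))
  □irr : ∀ x → □adj G H x x ≡ false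
  □irr (g , h) rewrite irref H h | irref G g
    with g == g | h == h
  ... | true  | true  = refl
  ... | true  | false = refl
  ... | false | true  = refl
  ... | false | false = refl

{-# OPTIONS --safe #-}
-- A graph without isolated vertices has a 2-colouring in which every vertex
-- has a neighbour of the other colour: colour a maximal independent set, e.g.
-- the greedy one, and its complement (Ore).  Colour (g , h) in G □ H by the sum
-- mod 2 of the colours of g and h.  Moving g to such a neighbour in G, or h to
-- such a neighbour in H, gives two distinct neighbours of (g , h) of the other
-- colour, so the two colour classes are disjoint 2-dominating sets.
module Submission where

open import Defs
open import Data.Nat as ℕ using (ℕ; zero; suc; _≤_; _<_; _≥_; s≤s)
open import Data.Nat.Properties using (<-irrefl; ≤-trans; n≤1+n; <-cmp; ≤∧≢⇒<; ≰⇒>)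
open import Data.Bool using (Bool; true; false; not; _xor_)
import Data.Bool.Properties as Bool
open import Data.Bool.Properties using (not-¬; ¬-not; ∨-zeroʳ; not-distribˡ-xor; not-distribʳ-xor)
open import Data.Fin using (Fin; toℕ; combine; remQuot; fromℕ<)
open import Data.Fin.Properties using (any?; toℕ-injective; remQuot-combine; combine-remQuot; combine-injectiveˡ)
import Data.Fin.Properties as Fin
open import Data.Fin.Subset using (Subset; Empty; _∈_; _∩_; ∣_∣; ⁅_⁆; _⊆_)
open import Data.Fin.Subset.Properties
  using (x∈p∩q⁺; x∈p∩q⁻; p⊆q⇒∣p∣≤∣q∣; ∣⁅x⁆∣≡1; x∈⁅y⁆⇒x≡y; x∈p∧x≢y⇒x∈p-y; x∈p⇒∣p-x∣<∣p∣)
open import Data.Vec using (tabulate)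
open import Data.Vec.Properties using (lookup∘tabulate; lookup⇒[]=; []=⇒lookup)
open import Data.Product using (∃; _×_; _,_; uncurry)
open import Relation.Binary.PropositionalEquality
open import Relation.Binary.Definitions using (tri<; tri≈; tri>)
open import Relation.Nullary using (¬_; Dec; yes; no; does; _×-dec_)
open import Relation.Nullary.Decidable using (dec-true; isYes≗does)
open import Data.Empty using (⊥-elim)
open import Function using (_∘_)

x∈p⇒∣p∣≥1 : ∀ {m} {p : Subset m} {x} → x ∈ p → ∣ p ∣ ≥ 1
x∈p⇒∣p∣≥1 {p = p} {x} x∈p = subst (_≤ ∣ p ∣) (∣⁅x⁆∣≡1 x) (p⊆q⇒∣p∣≤∣q∣ ⁅x⁆⊆p)
  where
  ⁅x⁆⊆p : ⁅ x ⁆ ⊆ p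
  ⁅x⁆⊆p y∈⁅x⁆ = subst (_∈ p) (sym (x∈⁅y⁆⇒x≡y x y∈⁅x⁆)) x∈p

x∈p∧y∈p∧x≢y⇒∣p∣≥2 : ∀ {m} {p : Subset m} {x y} → x ∈ p → y ∈ p → x ≢ y → ∣ p ∣ ≥ 2
x∈p∧y∈p∧x≢y⇒∣p∣≥2 x∈p y∈p x≢y =
  ≤-trans (s≤s (x∈p⇒∣p∣≥1 (x∈p∧x≢y⇒x∈p-y y∈p (x≢y ∘ sym)))) (x∈p⇒∣p-x∣<∣p∣ x∈p)

∈-tabulate⁺ : ∀ {m} {f : Fin m → Bool} {x} → f x ≡ true → x ∈ tabulate f
∈-tabulate⁺ {f = f} {x} fx≡true = lookup⇒[]= x (tabulate f) (trans (lookup∘tabulate f x) fx≡true)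

∈-tabulate⁻ : ∀ {m} {f : Fin m → Bool} {x} → x ∈ tabulate f → f x ≡ true
∈-tabulate⁻ {f = f} {x} x∈ = trans (sym (lookup∘tabulate f x)) ([]=⇒lookup x∈)

colourClass : ∀ {m} → (Fin m → Bool) → Bool → Subset m
colourClass χ b = tabulate (λ v → does (χ v Bool.≟ b))

∈-colourClass⁺ : ∀ {m} (χ : Fin m → Bool) {b v} → χ v ≡ b → v ∈ colourClass χ b
∈-colourClass⁺ χ {b} {v} χv≡b = ∈-tabulate⁺ (dec-true (χ v Bool.≟ b) χv≡b)

∈-colourClass⁻ : ∀ {m} (χ : Fin m → Bool) {b v} → v ∈ colourClass χ b → χ v ≡ b
∈-colourClass⁻ χ {b} {v} v∈ with χ v Bool.≟ b | ∈-tabulate⁻ v∈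
... | yes χv≡b | _ = χv≡b

twoTwoDominated-byColouring : (F : Graph) (χ : Fin (n F) → Bool) →
  (∀ b → ∃ λ v → χ v ≡ b) →
  (∀ v → ∣ N F v ∩ colourClass χ (not (χ v)) ∣ ≥ 2) →
  TwoTwoDominated F
twoTwoDominated-byColouring F χ onto twoOpposite =
  colourClass χ false , colourClass χ true ,
  proper false , proper true , disjoint , dominating false , dominating true
  where
  proper : ∀ b → Proper F (colourClass χ b)
  proper b with onto (not b)
  ... | v , χv≡¬b = v , λ v∈ → not-¬ (∈-colourClass⁻ χ v∈) χv≡¬b

  disjoint : Empty (colourClass χ false ∩ colourClass χ true)
  disjoint (v , v∈) with x∈p∩q⁻ (colourClass χ false) _ v∈
  ... | v∈false , v∈true with trans (sym (∈-colourClass⁻ χ v∈false)) (∈-colourClass⁻ χ v∈true)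
  ... | ()

  dominating : ∀ b → TwoDominating F (colourClass χ b)
  dominating b v v∉ = subst (λ c → ∣ N F v ∩ colourClass χ c ∣ ≥ 2) (sym b≡¬χv) (twoOpposite v)
    where
    b≡¬χv : b ≡ not (χ v)
    b≡¬χv = ¬-not (v∉ ∘ ∈-colourClass⁺ χ ∘ sym)

==-refl : ∀ {k} (i : Fin k) → (i == i) ≡ true
==-refl i = trans (isYes≗does (i Fin.≟ i)) (dec-true (i Fin.≟ i) refl)

adj⇒≢ : (G : Graph) {u v : Fin (n G)} → adj G u v ≡ true → u ≢ v
adj⇒≢ G {u} uv refl with trans (sym (irref G u)) uv
... | ()

NeighbourIn : (G : Graph) → (Fin (n G) → Bool) → Fin (n G) → Set
NeighbourIn G S v = ∃ λ u → adj G v u ≡ true × S u ≡ true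

neighbourIn? : (G : Graph) (S : Fin (n G) → Bool) (v : Fin (n G)) → Dec (NeighbourIn G S v)
neighbourIn? G S v = any? λ u → (adj G v u Bool.≟ true) ×-dec (S u Bool.≟ true)

-- stage k is the greedy maximal independent set of the vertices 0, …, k − 1,
-- scanned in index order.
module Greedy (G : Graph) where

  stage : ℕ → Fin (n G) → Bool
  stage zero    v = false
  stage (suc k) v with toℕ v ℕ.≟ k
  ... | yes _ = not (does (neighbourIn? G (stage k) v))
  ... | no _  = stage k v

  greedy : Fin (n G) → Bool
  greedy v = stage (suc (toℕ v)) v

  greedy-unfold : ∀ v → greedy v ≡ not (does (neighbourIn? G (stage (toℕ v)) v))
  greedy-unfold v with toℕ v ℕ.≟ toℕ v
  ... | yes _  = refl
  ... | no v≢v = ⊥-elim (v≢v refl)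

  stage-unreached : ∀ {k v} → k ≤ toℕ v → stage k v ≡ false
  stage-unreached {zero}  _ = refl
  stage-unreached {suc k} {v} k<v with toℕ v ℕ.≟ k
  ... | yes v≡k = ⊥-elim (<-irrefl (sym v≡k) k<v)
  ... | no _    = stage-unreached (≤-trans (n≤1+n k) k<v)

  stage-settled : ∀ {k v} → toℕ v < k → stage k v ≡ greedy v
  stage-settled {suc k} {v} (s≤s v≤k) with toℕ v ℕ.≟ k
  ... | yes refl = sym (greedy-unfold v)
  ... | no v≢k   = stage-settled (≤∧≢⇒< v≤k v≢k)

  greedy-true : ∀ {v} → greedy v ≡ true → ¬ NeighbourIn G (stage (toℕ v)) v
  greedy-true {v} gv with neighbourIn? G (stage (toℕ v)) v | trans (sym (greedy-unfold v)) gv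
  ... | no ¬nb | _ = ¬nb

  greedy-false : ∀ {v} → greedy v ≡ false → NeighbourIn G (stage (toℕ v)) v
  greedy-false {v} gv with neighbourIn? G (stage (toℕ v)) v | trans (sym (greedy-unfold v)) gv
  ... | yes nb | _ = nb

  greedy-independent : ∀ {u v} → adj G v u ≡ true → greedy v ≡ true → greedy u ≢ true
  greedy-independent {u} {v} vu gv gu with <-cmp (toℕ u) (toℕ v)
  ... | tri< u<v _ _ = greedy-true gv (u , vu , trans (stage-settled u<v) gu)
  ... | tri≈ _ u≡v _ = adj⇒≢ G vu (toℕ-injective (sym u≡v))
  ... | tri> _ _ v<u = greedy-true gu (v , trans (adj-sym G u v) vu , trans (stage-settled v<u) gv)

  greedy-dominating : ∀ {v} → greedy v ≡ false → ∃ λ u → adj G v u ≡ true × greedy u ≡ true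
  greedy-dominating {v} gv with greedy-false gv
  ... | u , vu , su = u , vu , trans (sym (stage-settled u<v)) su
    where
    u<v : toℕ u < toℕ v
    u<v = ≰⇒> λ v≤u → not-¬ (stage-unreached v≤u) su

record DomaticColouring (G : Graph) : Set where
  field
    colour            : Fin (n G) → Bool
    oppositeNeighbour : ∀ v → ∃ λ u → adj G v u ≡ true × colour u ≡ not (colour v)

noIsolated⇒domaticColouring : (G : Graph) → NoIsolated G → DomaticColouring G
noIsolated⇒domaticColouring G noIsolated = record
  { colour            = greedy
  ; oppositeNeighbour = opposite
  }
  where
  open Greedy G
  opposite : ∀ v → ∃ λ u → adj G v u ≡ true × greedy u ≡ not (greedy v)
  opposite v with greedy v in gv
  ... | false = greedy-dominating gv
  ... | true with noIsolated v
  ...   | u , vu = u , vu , ¬-not (greedy-independent vu gv)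

bothColours : ∀ {m} (χ : Fin m → Bool) {u w} → χ w ≡ not (χ u) → ∀ b → ∃ λ v → χ v ≡ b
bothColours χ {u} {w} χw≡¬χu b with χ u Bool.≟ b
... | yes χu≡b = u , χu≡b
... | no χu≢b  = w , trans χw≡¬χu (sym (¬-not (χu≢b ∘ sym)))

_⊗_ : ∀ {k l} → (Fin k → Bool) → (Fin l → Bool) → Fin (k ℕ.* l) → Bool
_⊗_ {k} {l} χ ψ x = uncurry (λ g h → χ g xor ψ h) (remQuot {k} l x)

module _ {k l} (χ : Fin k → Bool) (ψ : Fin l → Bool) where

  ⊗-combine : ∀ g h → (χ ⊗ ψ) (combine g h) ≡ χ g xor ψ h
  ⊗-combine g h = cong (uncurry λ g h → χ g xor ψ h) (remQuot-combine g h)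

  ⊗-flipˡ : ∀ {g g′} h → χ g′ ≡ not (χ g) → (χ ⊗ ψ) (combine g′ h) ≡ not ((χ ⊗ ψ) (combine g h))
  ⊗-flipˡ {g} {g′} h χg′≡¬χg = begin
    (χ ⊗ ψ) (combine g′ h)       ≡⟨ ⊗-combine g′ h ⟩
    χ g′ xor ψ h                 ≡⟨ cong (_xor ψ h) χg′≡¬χg ⟩
    not (χ g) xor ψ h            ≡⟨ not-distribˡ-xor (χ g) (ψ h) ⟨
    not (χ g xor ψ h)            ≡⟨ cong not (⊗-combine g h) ⟨
    not ((χ ⊗ ψ) (combine g h))  ∎
    where open ≡-Reasoning

  ⊗-flipʳ : ∀ g {h h′} → ψ h′ ≡ not (ψ h) → (χ ⊗ ψ) (combine g h′) ≡ not ((χ ⊗ ψ) (combine g h))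
  ⊗-flipʳ g {h} {h′} ψh′≡¬ψh = begin
    (χ ⊗ ψ) (combine g h′)       ≡⟨ ⊗-combine g h′ ⟩
    χ g xor ψ h′                 ≡⟨ cong (χ g xor_) ψh′≡¬ψh ⟩
    χ g xor not (ψ h)            ≡⟨ not-distribʳ-xor (χ g) (ψ h) ⟨
    not (χ g xor ψ h)            ≡⟨ cong not (⊗-combine g h) ⟨
    not ((χ ⊗ ψ) (combine g h))  ∎
    where open ≡-Reasoning

module _ (G H : Graph) where

  □-adj-combine : ∀ g g′ h h′ → adj (G □ H) (combine g h) (combine g′ h′) ≡ □adj G H (g , h) (g′ , h′)
  □-adj-combine g g′ h h′ = cong₂ (□adj G H) (remQuot-combine g h) (remQuot-combine g′ h′)

  □-adjˡ : ∀ {g g′} h → adj G g g′ ≡ true → adj (G □ H) (combine g h) (combine g′ h) ≡ true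
  □-adjˡ {g} {g′} h gg′ rewrite □-adj-combine g g′ h h | ==-refl h | gg′ = ∨-zeroʳ _

  □-adjʳ : ∀ g {h h′} → adj H h h′ ≡ true → adj (G □ H) (combine g h) (combine g h′) ≡ true
  □-adjʳ g {h} {h′} hh′ rewrite □-adj-combine g g h h′ | ==-refl g | hh′ = refl

  module _ (χ : DomaticColouring G) (ψ : DomaticColouring H) where
    open DomaticColouring

    □-colour : Fin (n (G □ H)) → Bool
    □-colour = colour χ ⊗ colour ψ

    □-colour-onto : Fin (n G) → Fin (n H) → ∀ b → ∃ λ v → □-colour v ≡ b
    □-colour-onto g h with oppositeNeighbour χ g
    ... | _ , _ , χg′≡¬χg = bothColours □-colour (⊗-flipˡ (colour χ) (colour ψ) h χg′≡¬χg)

    □-twoOppositeNeighbours : ∀ x → ∣ N (G □ H) x ∩ colourClass □-colour (not (□-colour x)) ∣ ≥ 2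
    □-twoOppositeNeighbours x =
      subst TwoOpposite (combine-remQuot {n G} (n H) x) (uncurry atCombine (remQuot {n G} (n H) x))
      where
      TwoOpposite : Fin (n (G □ H)) → Set
      TwoOpposite y = ∣ N (G □ H) y ∩ colourClass □-colour (not (□-colour y)) ∣ ≥ 2

      atCombine : ∀ g h → TwoOpposite (combine g h)
      atCombine g h with oppositeNeighbour χ g | oppositeNeighbour ψ h
      ... | g′ , gg′ , χg′≡¬χg | h′ , hh′ , ψh′≡¬ψh = x∈p∧y∈p∧x≢y⇒∣p∣≥2
        (x∈p∩q⁺ (∈-tabulate⁺ (□-adjˡ h gg′) ,
                 ∈-colourClass⁺ □-colour (⊗-flipˡ (colour χ) (colour ψ) h χg′≡¬χg)))
        (x∈p∩q⁺ (∈-tabulate⁺ (□-adjʳ g hh′) ,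
                 ∈-colourClass⁺ □-colour (⊗-flipʳ (colour χ) (colour ψ) g ψh′≡¬ψh)))
        (λ eq → adj⇒≢ G gg′ (sym (combine-injectiveˡ g′ h g h′ eq)))

corollary2p4 : (G H : Graph) → n G ≥ 1 → n H ≥ 1 →
    NoIsolated G → NoIsolated H → TwoTwoDominated (G □ H)
corollary2p4 G H nG≥1 nH≥1 noIsolatedG noIsolatedH =
  twoTwoDominated-byColouring (G □ H) (□-colour G H χ ψ)
    (□-colour-onto G H χ ψ (fromℕ< nG≥1) (fromℕ< nH≥1))
    (□-twoOppositeNeighbours G H χ ψ)
  where
  χ : DomaticColouring G
  χ = noIsolated⇒domaticColouring G noIsolatedG
  ψ : DomaticColouring H
  ψ = noIsolated⇒domaticColouring H noIsolatedH
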